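{- Let $G$ be a graph on $n$ vertices and let $m,k$ be integers with $1\leq m<k\leq n$. If $\psi_k(G)>0$, then $\psi_m(G)\geq \psi_k(G)+\left\lfloor \frac{k}{m}\right\rfloor-1$.
   Context: All graphs are finite, simple and nonempty. For a graph $G=(V,E)$ and a positive integer $k$, a $k$-path vertex cover ($k$-PVC) of $G$ is a set $S\subseteq V$ such that every path on $k$ vertices in $G$ contains at least one vertex of $S$. $\psi_k(G)$ denotes the minimum cardinality of a $k$-PVC of $G$ (defined for $1\leq k\leq |V|$). -}

module Defs where

open import Data.Nat using (ℕ; zero; suc; _≤_; _<_)
open import Data.Nat.Properties using (<-trans; n<1+n)
open import Data.Fin using (fromℕ<)
open import Data.Fin using (Fin)
open import Data.Fin.Subset using (Subset; _∈_; ∣_∣)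
open import Data.Vec using (Vec; lookup)
open import Data.Product using (Σ; ∃; _×_; _,_)
open import Relation.Binary.PropositionalEquality using (_≡_)
open import Relation.Nullary using (¬_)

record Graph (n : ℕ) : Set₁ where
  field
    Adj   : Fin n → Fin n → Set
    irrefl : ∀ {u} → ¬ Adj u u
    sym    : ∀ {u v} → Adj u v → Adj v u

open Graph public

record IsPath {n : ℕ} (G : Graph n) (k : ℕ) (p : Vec (Fin n) k) : Set where
  field
    distinct : ∀ (i j : Fin k) → lookup p i ≡ lookup p j → i ≡ j
    adjacent : ∀ (i : ℕ) (h : suc i < k) →
               Adj G (lookup p (fromℕ< (<-trans (n<1+n i) h)))
                     (lookup p (fromℕ< h))

IsPVC : {n : ℕ} → Graph n → ℕ → Subset n → Set
IsPVC {n} G k S = ∀ (p : Vec (Fin n) k) → IsPath G k p → ∃ λ (i : Fin k) → lookup p i ∈ S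

IsPsi : {n : ℕ} → Graph n → ℕ → ℕ → Set
IsPsi {n} G k s =
  (Σ (Subset n) λ S → IsPVC G k S × ∣ S ∣ ≡ s) ×
  (∀ (S : Subset n) → IsPVC G k S → s ≤ ∣ S ∣)

module Submission where

-- Let S be a minimum m-path vertex cover and t = ⌊k/m⌋.  A path
-- on k vertices contains t vertex-disjoint consecutive windows of m vertices;
-- each window is itself a path on m vertices and therefore meets S.  Hence S
-- meets every k-path in at least t distinct positions.  Deleting one vertex of
-- S lowers this multiplicity by at most one (and, because the vertices of a
-- path are distinct, removing v costs at most the one position where v sits).
-- So after deleting t - 1 vertices of S we still have a k-path vertex cover,
-- of size |S| - (t - 1); the hypothesis ψ_k(G) > 0 guarantees that S never
-- runs out of vertices while we delete.  Comparing with ψ_k(G) gives the claim.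

open import Defs using (Graph; Adj; IsPath; IsPVC; IsPsi)
open import Data.Nat using (ℕ; zero; suc; s≤s; _+_; _*_; _∸_; _/_; _≤_; _<_; _>_; NonZero; >-nonZero)
open import Data.Nat.Properties
open import Data.Nat.DivMod using (m/n*n≤m; m≥n⇒m/n>0)
open import Data.Fin using (Fin; zero; toℕ; fromℕ<; combine; punchIn)
  renaming (_≟_ to _≟ᶠ_)
open import Data.Fin.Properties
  using (toℕ<n; toℕ-injective; toℕ-fromℕ<; toℕ-combine; combine-injectiveˡ;
         punchIn-injective; punchInᵢ≢i; any?)
open import Data.Fin.Subset using (Subset; _∈_; ∣_∣; _-_; Nonempty)
open import Data.Fin.Subset.Properties
  using (nonempty?; Empty-unique; ∣⊥∣≡0; x∈p∧x≢y⇒x∈p-y; x∈p⇒∣p-x∣<∣p∣)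
open import Data.Vec using (Vec; lookup; tabulate)
open import Data.Vec.Properties using (lookup∘tabulate)
open import Data.Product using (Σ; ∃; _×_; _,_; proj₁; proj₂)
open import Function.Definitions using (Injective)
open import Relation.Binary.PropositionalEquality
open import Relation.Nullary using (yes; no; contradiction)

nonempty-of-card : ∀ {n} (S : Subset n) → 0 < ∣ S ∣ → Nonempty S
nonempty-of-card {n} S 0<∣S∣ with nonempty? S
... | yes ne = ne
... | no ¬ne = contradiction (trans (cong ∣_∣ (Empty-unique ¬ne)) (∣⊥∣≡0 n)) (>⇒≢ 0<∣S∣)

module Window {k m : ℕ} (o : ℕ) (fits : o + m ≤ k) where

  shift : Fin m → Fin k
  shift i = fromℕ< (<-≤-trans (+-monoʳ-< o (toℕ<n i)) fits)

  toℕ-shift : ∀ i → toℕ (shift i) ≡ o + toℕ i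
  toℕ-shift i = toℕ-fromℕ< _

  shift-injective : Injective _≡_ _≡_ shift
  shift-injective {i} {j} eq = toℕ-injective (+-cancelˡ-≡ o (toℕ i) (toℕ j) (begin
    o + toℕ i     ≡⟨ toℕ-shift i ⟨
    toℕ (shift i) ≡⟨ cong toℕ eq ⟩
    toℕ (shift j) ≡⟨ toℕ-shift j ⟩
    o + toℕ j     ∎))
    where open ≡-Reasoning

  fromℕ<-shift : ∀ {a b} (a<m : a < m) (b<k : b < k) → b ≡ o + a →
                 fromℕ< b<k ≡ shift (fromℕ< a<m)
  fromℕ<-shift a<m b<k b≡o+a = toℕ-injective (begin
    toℕ (fromℕ< b<k)          ≡⟨ toℕ-fromℕ< b<k ⟩
    _                         ≡⟨ b≡o+a ⟩
    o + _                     ≡⟨ cong (o +_) (toℕ-fromℕ< a<m) ⟨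
    o + toℕ (fromℕ< a<m)      ≡⟨ toℕ-shift (fromℕ< a<m) ⟨
    toℕ (shift (fromℕ< a<m))  ∎)
    where open ≡-Reasoning

  window : ∀ {A : Set} → Vec A k → Vec A m
  window p = tabulate (λ i → lookup p (shift i))

  window-path : ∀ {n} (G : Graph n) (p : Vec (Fin n) k) → IsPath G k p → IsPath G m (window p)
  IsPath.distinct (window-path G p P) i j eq =
    shift-injective (IsPath.distinct P _ _
      (trans (sym (lookup∘tabulate _ i)) (trans eq (lookup∘tabulate _ j))))
  IsPath.adjacent (window-path G p P) i i+1<m =
    subst₂ (Adj G) (at (<-trans (n<1+n i) i+1<m) (<-trans (n<1+n (o + i)) o+i+1<k) refl)
                   (at i+1<m o+i+1<k (sym (+-suc o i)))
      (IsPath.adjacent P (o + i) o+i+1<k)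
    where
      o+i+1<k : suc (o + i) < k
      o+i+1<k = subst (_< k) (+-suc o i) (<-≤-trans (+-monoʳ-< o i+1<m) fits)

      at : ∀ {a b} (a<m : a < m) (b<k : b < k) → b ≡ o + a →
           lookup p (fromℕ< b<k) ≡ lookup (window p) (fromℕ< a<m)
      at a<m b<k eq = trans (cong (lookup p) (fromℕ<-shift a<m b<k eq))
                            (sym (lookup∘tabulate _ (fromℕ< a<m)))

module _ {n} (G : Graph n) (k : ℕ) where

  MeetsAtLeast : ℕ → Subset n → Set
  MeetsAtLeast r S = ∀ p → IsPath G k p →
    Σ (Fin r → Fin k) λ pos → Injective _≡_ _≡_ pos × (∀ i → lookup p (pos i) ∈ S)

  meetsAtLeast⇒pvc : ∀ {r} S → MeetsAtLeast (suc r) S → IsPVC G k S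
  meetsAtLeast⇒pvc S meets p P = let (pos , _ , pos∈S) = meets p P in pos zero , pos∈S zero

  avoidAllBut : ∀ {r} p → IsPath G k p → (pos : Fin (suc r) → Fin k) → Injective _≡_ _≡_ pos →
                (v : Fin n) → ∃ λ q → ∀ j → j ≢ q → lookup p (pos j) ≢ v
  avoidAllBut p P pos pos-inj v with any? (λ q → lookup p (pos q) ≟ᶠ v)
  ... | yes (q , pq≡v) = q , λ j j≢q pj≡v →
          j≢q (pos-inj (IsPath.distinct P _ _ (trans pj≡v (sym pq≡v))))
  ... | no none = zero , λ j _ pj≡v → none (j , pj≡v)

  meetsAtLeast-remove : ∀ {r} S v → MeetsAtLeast (suc r) S → MeetsAtLeast r (S - v)
  meetsAtLeast-remove S v meets p P
    with pos , pos-inj , pos∈S ← meets p P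
    with q , avoid ← avoidAllBut p P pos pos-inj v
    = (λ j → pos (punchIn q j)) , (λ eq → punchIn-injective q _ _ (pos-inj eq)) ,
      λ j → x∈p∧x≢y⇒x∈p-y (pos∈S _) (avoid (punchIn q j) (punchInᵢ≢i q j))

  shrinkCover : (∀ S → IsPVC G k S → 0 < ∣ S ∣) →
                ∀ j S → MeetsAtLeast (suc j) S → Σ (Subset n) λ S′ → IsPVC G k S′ × j + ∣ S′ ∣ ≤ ∣ S ∣
  shrinkCover noEmptyCover zero S meets = S , meetsAtLeast⇒pvc S meets , ≤-refl
  shrinkCover noEmptyCover (suc j) S meets
    with v , v∈S ← nonempty-of-card S (noEmptyCover S (meetsAtLeast⇒pvc S meets))
    with S′ , S′-pvc , j+∣S′∣≤∣S-v∣ ← shrinkCover noEmptyCover j (S - v) (meetsAtLeast-remove S v meets)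
    = S′ , S′-pvc , <-≤-trans (s≤s j+∣S′∣≤∣S-v∣) (x∈p⇒∣p-x∣<∣p∣ v∈S)

-- A path on k ≥ t·m vertices splits into t disjoint windows of m vertices,
-- each of which meets any m-path vertex cover; so such a cover meets every
-- k-path at least t times.
pvc⇒meetsAtLeast : ∀ {n} (G : Graph n) {m k} t → t * m ≤ k →
                   ∀ S → IsPVC G m S → MeetsAtLeast G k t S
pvc⇒meetsAtLeast G {m} {k} t tm≤k S pvc p P = pos , pos-injective , pos∈S
  where
    block-fits : (b : Fin t) → m * toℕ b + m ≤ k
    block-fits b = begin
      m * toℕ b + m    ≡⟨ +-comm (m * toℕ b) m ⟩
      m + m * toℕ b    ≡⟨ *-suc m (toℕ b) ⟨
      m * suc (toℕ b)  ≤⟨ *-monoʳ-≤ m (toℕ<n b) ⟩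
      m * t            ≡⟨ *-comm m t ⟩
      t * m            ≤⟨ tm≤k ⟩
      k                ∎
      where open ≤-Reasoning

    module Block (b : Fin t) = Window (m * toℕ b) (block-fits b)

    hit : (b : Fin t) → ∃ λ i → lookup (Block.window b p) i ∈ S
    hit b = pvc (Block.window b p) (Block.window-path b G p P)

    pos : Fin t → Fin k
    pos b = Block.shift b (proj₁ (hit b))

    -- Block b occupies the positions combine b i, so distinct blocks give
    -- distinct positions.
    toℕ-pos : ∀ b → toℕ (pos b) ≡ toℕ (combine b (proj₁ (hit b)))
    toℕ-pos b = trans (Block.toℕ-shift b _) (sym (toℕ-combine b _))

    pos-injective : Injective _≡_ _≡_ pos
    pos-injective {b} {b′} eq = combine-injectiveˡ b _ b′ _
      (toℕ-injective (trans (sym (toℕ-pos b)) (trans (cong toℕ eq) (toℕ-pos b′))))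

    pos∈S : ∀ b → lookup p (pos b) ∈ S
    pos∈S b = subst (_∈ S) (lookup∘tabulate _ (proj₁ (hit b))) (proj₂ (hit b))

pvc-gap : ∀ {n} (G : Graph n) {m k} s → suc s * m ≤ k → (∀ S → IsPVC G k S → 0 < ∣ S ∣) →
          ∀ S → IsPVC G m S → Σ (Subset n) λ S′ → IsPVC G k S′ × s + ∣ S′ ∣ ≤ ∣ S ∣
pvc-gap G s fits noEmptyCover S pvc =
  shrinkCover G _ noEmptyCover s S (pvc⇒meetsAtLeast G (suc s) fits S pvc)

mainTheorem2 : ∀ {n} (G : Graph n) (m k : ℕ) (1≤m : 1 ≤ m) (m<k : m < k) (k≤n : k ≤ n)
    (ψm ψk : ℕ) → IsPsi G m ψm → IsPsi G k ψk → ψk > 0 →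
    ψk + (_/_ k m {{>-nonZero 1≤m}}) ∸ 1 ≤ ψm
mainTheorem2 G m k 1≤m m<k _ ψm ψk ((S , S-pvc , ∣S∣≡ψm) , _) (_ , ψk-min) ψk>0 =
  let S′ , S′-pvc , s+∣S′∣≤∣S∣ = pvc-gap G (t ∸ 1) fits noEmptyCover S S-pvc in begin
    ψk + t ∸ 1      ≡⟨ +-∸-assoc ψk 1≤t ⟩
    ψk + (t ∸ 1)    ≤⟨ +-monoˡ-≤ (t ∸ 1) (ψk-min S′ S′-pvc) ⟩
    ∣ S′ ∣ + (t ∸ 1) ≡⟨ +-comm ∣ S′ ∣ (t ∸ 1) ⟩
    (t ∸ 1) + ∣ S′ ∣ ≤⟨ s+∣S′∣≤∣S∣ ⟩
    ∣ S ∣           ≡⟨ ∣S∣≡ψm ⟩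
    ψm              ∎
  where
    open ≤-Reasoning
    instance
      m≢0 : NonZero m
      m≢0 = >-nonZero 1≤m

    t : ℕ
    t = k / m

    1≤t : 1 ≤ t
    1≤t = m≥n⇒m/n>0 (<⇒≤ m<k)

    fits : suc (t ∸ 1) * m ≤ k
    fits = subst (λ x → x * m ≤ k) (sym (m+[n∸m]≡n 1≤t)) (m/n*n≤m k m)

    noEmptyCover : ∀ S → IsPVC G k S → 0 < ∣ S ∣
    noEmptyCover S pvc = <-≤-trans ψk>0 (ψk-min S pvc)
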